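{- For every positive integer $n$ and every prime $p$ there is $k_0$ such that for every integer $k\ge k_0$ the number $np^k$ satisfies Condition 1 with $p$ and another prime: there is a prime $q\neq p$ such that for every integer $j$ with $1\le j\le np^k-1$, the binomial coefficient $\binom{np^k}{j}$ is divisible by $p$ or by $q$.
   Context: A positive integer $N$ satisfies Condition 1 with primes $p$ and $q$ if for all integers $j$ with $1\le j\le N-1$ the binomial coefficient $\binom{N}{j}$ is divisible by $p$ or by $q$. -}

module Defs where

open import Data.Nat using (ℕ; _≤_; _∸_)
open import Data.Nat.Divisibility using (_∣_)
open import Data.Nat.Combinatorics using (_C_)
open import Data.Sum using (_⊎_)

Condition1 : ℕ → ℕ → ℕ → Set
Condition1 N p q = (j : ℕ) → 1 ≤ j → j ≤ N ∸ 1 → (p ∣ N C j) ⊎ (q ∣ N C j)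

module Submission where

-- Let N = n·pᵏ with k large.  Put M = qᵉ, a prime power dividing pᵏ + 1
-- with n ≤ M; it exists once pᵏ + 1 > n!, because a number all of whose
-- prime-power divisors are at most n divides n!.  Then q ≠ p, and
--
--  * (Kummer-type criterion) for a prime power qᵉ,  N mod qᵉ < j mod qᵉ
--    implies q ∣ C(N, j); this follows by induction from Pascal's rule and
--    the absorption identity (j+1)·C(N+1, j+1) = (N+1)·C(N, j);
--  * if pᵏ ∤ j then N mod pᵏ = 0 < j mod pᵏ, so p ∣ C(N, j);
--  * if j = m·pᵏ with 0 < m < n then, as pᵏ ≡ -1 (mod M),
--    N mod M = M - n < M - m = j mod M, so q ∣ C(N, j).

open import Defs
open import Data.Nat
open import Data.Nat.Properties
open import Data.Nat.Divisibility
open import Data.Nat.DivMod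
open import Data.Nat.Combinatorics using (_C_; nC1≡n; nCk+nC[k+1]≡[n+1]C[k+1])
open import Data.Nat.Primality
open import Data.Nat.Primality.Factorisation using (factorise)
open import Data.Nat.ListAction using (product)
open import Data.Nat.Induction using (<-wellFounded)
open import Induction.WellFounded using (Acc; acc)
open import Data.List using ([]; _∷_)
open import Data.List.Relation.Unary.All using (_∷_)
open import Data.Product using (Σ; _×_; _,_)
open import Data.Sum using (_⊎_; inj₁; inj₂)
open import Data.Empty using (⊥-elim)
open import Relation.Nullary using (¬_; yes; no)
open import Relation.Binary.PropositionalEquality

prime>1 : ∀ {q} → Prime q → 1 < q
prime>1 {q} pq = nonTrivial⇒n>1 q {{prime⇒nonTrivial pq}}

absorption : ∀ n k → suc k * (suc n C suc k) ≡ suc n * (n C k)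
absorption zero    zero    = refl
absorption zero    (suc k) = *-zeroʳ (suc (suc k))
absorption (suc n) zero    =
  trans (+-identityʳ _) (trans (nC1≡n (suc (suc n))) (sym (*-identityʳ (suc (suc n)))))
absorption (suc n) (suc k) = begin
  suc (suc k) * (suc (suc n) C suc (suc k))
    ≡⟨ cong (suc (suc k) *_) (sym (nCk+nC[k+1]≡[n+1]C[k+1] (suc n) (suc k))) ⟩
  suc (suc k) * (a + b)
    ≡⟨ *-distribˡ-+ (suc (suc k)) a b ⟩
  (a + suc k * a) + suc (suc k) * b
    ≡⟨ cong₂ (λ u v → (a + u) + v) (absorption n k) (absorption n (suc k)) ⟩
  (a + suc n * (n C k)) + suc n * (n C suc k)
    ≡⟨ +-assoc a _ _ ⟩
  a + (suc n * (n C k) + suc n * (n C suc k))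
    ≡⟨ cong (a +_) (sym (*-distribˡ-+ (suc n) (n C k) (n C suc k))) ⟩
  a + suc n * (n C k + n C suc k)
    ≡⟨ cong (λ u → a + suc n * u) (nCk+nC[k+1]≡[n+1]C[k+1] n k) ⟩
  a + suc n * a
    ∎
  where
  open ≡-Reasoning
  a = suc n C suc k
  b = suc n C suc (suc k)

prime-power-cancel : ∀ {q} → Prime q → ∀ e x c → ¬ q ∣ c → q ^ e ∣ x * c → q ^ e ∣ x
prime-power-cancel pq zero x c q∤c _ = 1∣ x
prime-power-cancel {q} pq (suc e) x c q∤c qᵉ⁺¹∣xc
  with euclidsLemma x c pq (∣-trans (m∣m*n (q ^ e)) qᵉ⁺¹∣xc)
... | inj₂ q∣c = ⊥-elim (q∤c q∣c)
... | inj₁ (divides y refl) = subst (q ^ suc e ∣_) (*-comm q y) (*-monoʳ-∣ q qᵉ∣y)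
  where
  qᵉ∣y : q ^ e ∣ y
  qᵉ∣y = prime-power-cancel pq e y c q∤c (*-cancelˡ-∣ q {{prime⇒nonZero pq}}
           (subst (q * q ^ e ∣_) (trans (cong (_* c) (*-comm y q)) (*-assoc q y c)) qᵉ⁺¹∣xc))

prime-power-split : ∀ {q} → Prime q → ∀ A → .{{NonZero A}} →
  Σ ℕ λ e → Σ ℕ λ B → A ≡ q ^ e * B × ¬ q ∣ B
prime-power-split {q} pq A = go A (<-wellFounded A)
  where
  go : ∀ A → Acc _<_ A → .{{NonZero A}} → Σ ℕ λ e → Σ ℕ λ B → A ≡ q ^ e * B × ¬ q ∣ B
  go A (acc rec) with q ∣? A
  ... | no q∤A = 0 , A , sym (+-identityʳ A) , q∤A
  ... | yes (divides A′ refl)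
    with go A′ (rec (m<m*n A′ q {{m*n≢0⇒m≢0 A′}} (prime>1 pq))) {{m*n≢0⇒m≢0 A′}}
  ...   | e , B , refl , q∤B = suc e , B , reorder , q∤B
    where
    reorder : q ^ e * B * q ≡ q * q ^ e * B
    reorder = trans (*-comm (q ^ e * B) q) (sym (*-assoc q (q ^ e) B))

%-unique : ∀ {x r} t M .{{_ : NonZero M}} → r < M → x ≡ r + t * M → x % M ≡ r
%-unique {r = r} t M r<M refl = trans ([m+kn]%n≡m%n r t M) (m<n⇒m%n≡m r<M)

%-suc : ∀ x M .{{_ : NonZero M}} → suc x % M ≡ 0 ⊎ suc x % M ≡ suc (x % M)
%-suc x M with suc (x % M) <? M
... | yes r+1<M = inj₂ (%-unique (x / M) M r+1<M (cong suc (m≡m%n+[m/n]*n x M)))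
... | no  r+1≮M = inj₁ (%-unique (suc (x / M)) M (>-nonZero⁻¹ M) wraps)
  where
  open ≡-Reasoning
  wraps : suc x ≡ 0 + suc (x / M) * M
  wraps = begin
    suc x                   ≡⟨ cong suc (m≡m%n+[m/n]*n x M) ⟩
    suc (x % M) + x / M * M ≡⟨ cong (_+ x / M * M) (≤-antisym (m%n<n x M) (≮⇒≥ r+1≮M)) ⟩
    M + x / M * M           ∎

%-negate : ∀ {P} M .{{_ : NonZero M}} → M ∣ suc P → ∀ x → 0 < x → x ≤ M → x * P % M ≡ M ∸ x
%-negate {P} M (divides t P+1≡tM) x 0<x x≤M with x * t in x*t≡
... | suc u = %-unique u M (∸-monoʳ-< 0<x x≤M) (+-cancelˡ-≡ x _ _ expand)
  where
  open ≡-Reasoning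
  expand : x + x * P ≡ x + ((M ∸ x) + u * M)
  expand = begin
    x + x * P           ≡⟨ sym (*-suc x P) ⟩
    x * suc P           ≡⟨ cong (x *_) P+1≡tM ⟩
    x * (t * M)         ≡⟨ sym (*-assoc x t M) ⟩
    x * t * M           ≡⟨ cong (_* M) x*t≡ ⟩
    M + u * M           ≡⟨ cong (_+ u * M) (sym (m+[n∸m]≡n x≤M)) ⟩
    x + (M ∸ x) + u * M ≡⟨ +-assoc x (M ∸ x) (u * M) ⟩
    x + ((M ∸ x) + u * M) ∎
... | zero with m*n≡0⇒m≡0∨n≡0 x x*t≡
...   | inj₁ refl = ⊥-elim (<-irrefl refl 0<x)
...   | inj₂ refl = ⊥-elim (0≢1+n (sym P+1≡tM))

-- Induction on N and j along Pascal's rule; when N + 1 is a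
-- multiple of qᵉ the absorption identity shows qᵉ ∣ j + 1 unless q ∣ C(N+1, j+1).
binomial-prime-divisor : ∀ {q} → Prime q → ∀ e N j → let M = q ^ e in
  .{{_ : NonZero M}} → N % M < j % M → q ∣ N C j
binomial-prime-divisor pq e zero    zero    r<s = ⊥-elim (<-irrefl refl r<s)
binomial-prime-divisor pq e zero    (suc j) _   = _ ∣0
binomial-prime-divisor {q} pq e (suc N) zero r<s =
  ⊥-elim (n≮0 (subst (suc N % q ^ e <_) (n∣m⇒m%n≡0 0 (q ^ e) ((q ^ e) ∣0)) r<s))
binomial-prime-divisor {q} pq e (suc N) (suc j) r<s with %-suc N (q ^ e)
... | inj₁ wraps with q ∣? (suc N C suc j)
...   | yes q∣C = q∣C
...   | no  q∤C = ⊥-elim (<-irrefl (sym (n∣m⇒m%n≡0 (suc j) (q ^ e) qᵉ∣j+1)) (subst (_< _) wraps r<s))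
  where
  qᵉ∣j+1 : q ^ e ∣ suc j
  qᵉ∣j+1 = prime-power-cancel pq e (suc j) (suc N C suc j) q∤C
             (subst (q ^ e ∣_) (sym (absorption N j))
               (∣-trans (m%n≡0⇒n∣m (suc N) (q ^ e) wraps) (m∣m*n (N C j))))
binomial-prime-divisor {q} pq e (suc N) (suc j) r<s | inj₂ N-steps with %-suc j (q ^ e)
... | inj₁ j-wraps = ⊥-elim (n≮0 (subst (_ <_) j-wraps r<s))
... | inj₂ j-steps = subst (q ∣_) (nCk+nC[k+1]≡[n+1]C[k+1] N j)
        (∣m∣n⇒∣m+n (binomial-prime-divisor pq e N j r<s′)
                    (binomial-prime-divisor pq e N (suc j) (subst (_ <_) (sym j-steps) (m<n⇒m<1+n r<s′))))
  where
  r<s′ : N % q ^ e < j % q ^ e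
  r<s′ = s<s⁻¹ (subst₂ _<_ N-steps j-steps r<s)

prime-divisor : ∀ A .{{_ : NonZero A}} → 1 < A → Σ ℕ λ q → Prime q × q ∣ A
prime-divisor A 1<A with factorise A
... | record { factors = [] ; isFactorisation = A≡1 } = ⊥-elim (<-irrefl (sym A≡1) 1<A)
... | record { factors = q ∷ qs ; isFactorisation = A≡∏ ; factorsPrime = pq ∷ _ } =
  q , pq , subst (q ∣_) (sym A≡∏) (m∣m*n (product qs))

∣-factorial : ∀ {m n} → 0 < m → m ≤ n → m ∣ n !
∣-factorial {suc m} _ m≤n = ∣-trans (divides (m !) (*-comm (suc m) (m !))) (m≤n⇒m!∣n! m≤n)

prime-power-combine : ∀ {q} → Prime q → ∀ e {B x} → ¬ q ∣ B → q ^ e ∣ x → B ∣ x → q ^ e * B ∣ x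
prime-power-combine {q} pq e q∤B qᵉ∣x (divides c refl) with prime-power-cancel pq e c _ q∤B qᵉ∣x
... | divides c′ refl = divides c′ (*-assoc c′ (q ^ e) _)

-- A positive number either divides n! or has a nontrivial prime-power divisor
-- exceeding n: split off the full power of a prime factor and recurse on the rest.
factorial-or-large-prime-power : ∀ n A → .{{NonZero A}} →
  A ∣ n ! ⊎ Σ ℕ λ q → Σ ℕ λ e → Prime q × q ^ suc e ∣ A × n < q ^ suc e
factorial-or-large-prime-power n A = go A (<-wellFounded A)
  where
  Goal : ℕ → Set
  Goal A = A ∣ n ! ⊎ Σ ℕ λ q → Σ ℕ λ e → Prime q × q ^ suc e ∣ A × n < q ^ suc e
  go : ∀ A → Acc _<_ A → .{{NonZero A}} → Goal A
  go 1 _ = inj₁ (1∣ (n !))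
  go A@(suc (suc _)) (acc rec) with prime-divisor A (s≤s (s≤s z≤n))
  ... | q , pq , q∣A with prime-power-split pq A
  ...   | zero , B , A≡B , q∤B = ⊥-elim (q∤B (subst (q ∣_) (trans A≡B (+-identityʳ B)) q∣A))
  ...   | suc e , B , A≡qᵉB , q∤B with n <? q ^ suc e
  ...     | yes large = inj₂ (q , e , pq , divides B (trans A≡qᵉB (*-comm (q ^ suc e) B)) , large)
  ...     | no  small with go B (rec B<A) {{B≢0}}
    where
    B≢0 : NonZero B
    B≢0 = m*n≢0⇒n≢0 (q ^ suc e) {{subst NonZero A≡qᵉB _}}
    1<qᵉ⁺¹ : 1 < q ^ suc e
    1<qᵉ⁺¹ = <-≤-trans (prime>1 pq) (m≤m*n q (q ^ e) {{m^n≢0 q e {{prime⇒nonZero pq}}}})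
    B<A : B < A
    B<A = subst (B <_) (trans (*-comm B (q ^ suc e)) (sym A≡qᵉB)) (m<m*n B (q ^ suc e) {{B≢0}} 1<qᵉ⁺¹)
  ...       | inj₁ B∣n! = inj₁ (subst (_∣ n !) (sym A≡qᵉB)
                (prime-power-combine pq (suc e) q∤B
                  (∣-factorial (m^n>0 q {{prime⇒nonZero pq}} (suc e)) (≮⇒≥ small)) B∣n!))
  ...       | inj₂ (r , f , pr , rᶠ⁺¹∣B , large) =
                inj₂ (r , f , pr , ∣-trans rᶠ⁺¹∣B (divides (q ^ suc e) A≡qᵉB) , large)

-- If qᵉ ∣ pᵏ + 1 and n ≤ qᵉ then n·pᵏ satisfies Condition 1 with p and q:
-- p handles the j not divisible by pᵏ, q the multiples j = m·pᵏ (0 < m < n).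
condition1-from-prime-powers : ∀ {p q} → Prime p → Prime q → ∀ k e n → 0 < n →
  n ≤ q ^ e → q ^ e ∣ suc (p ^ k) → Condition1 (n * p ^ k) p q
condition1-from-prime-powers {p} {q} pp pq k e n 0<n n≤M M∣P+1 = condition
  where
  P M N : ℕ
  P = p ^ k
  M = q ^ e
  N = n * P
  instance
    P≢0 : NonZero P
    P≢0 = m^n≢0 p k {{prime⇒nonZero pp}}
    M≢0 : NonZero M
    M≢0 = m^n≢0 q e {{prime⇒nonZero pq}}
    N≢0 : NonZero N
    N≢0 = m*n≢0 n P {{>-nonZero 0<n}}

  condition : Condition1 N p q
  condition j 1≤j j≤N-1 with P ∣? j
  ... | no P∤j = inj₁ (binomial-prime-divisor pp k N j N%P<j%P)
    where
    N%P<j%P : N % P < j % P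
    N%P<j%P = subst (_< j % P) (sym (n∣m⇒m%n≡0 N P (divides n refl)))
                (n≢0⇒n>0 (λ j%P≡0 → P∤j (m%n≡0⇒n∣m j P j%P≡0)))
  ... | yes (divides zero refl) = ⊥-elim (n≮0 1≤j)
  ... | yes (divides m@(suc _) refl) = inj₂ (binomial-prime-divisor pq e N (m * P) N%M<j%M)
    where
    m<n : m < n
    m<n = *-cancelʳ-< P m n (m≤pred[n]⇒suc[m]≤n j≤N-1)
    N%M<j%M : N % M < m * P % M
    N%M<j%M = subst₂ _<_ (sym (%-negate M M∣P+1 n 0<n n≤M))
                (sym (%-negate M M∣P+1 m z<s (<⇒≤ (<-≤-trans m<n n≤M))))
                (∸-monoʳ-< m<n n≤M)

n<m^n : ∀ {m} → 1 < m → ∀ k → k < m ^ k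
n<m^n 1<m zero = z<s
n<m^n {m} 1<m (suc k) = <-≤-trans (s<s (n<m^n 1<m k)) mᵏ<m·mᵏ
  where
  mᵏ<m·mᵏ : m ^ k < m * m ^ k
  mᵏ<m·mᵏ = subst (m ^ k <_) (*-comm (m ^ k) m)
              (m<m*n (m ^ k) m {{m^n≢0 m k {{>-nonZero (<-trans z<s 1<m)}}}} 1<m)

∤-suc-power : ∀ {p} → 1 < p → ∀ k → ¬ p ∣ suc (p ^ suc k)
∤-suc-power {p} 1<p k p∣pᵏ⁺¹+1 = <⇒≢ 1<p (sym (∣1⇒≡1 p∣1))
  where
  p∣1 : p ∣ 1
  p∣1 = ∣m+n∣m⇒∣n (subst (p ∣_) (+-comm 1 (p ^ suc k)) p∣pᵏ⁺¹+1) (m∣m*n (p ^ k))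

-- For k > n! the number pᵏ + 1 exceeds n!, so it has a prime-power divisor
-- qᵉ > n; then q ≠ p and Condition 1 holds for n·pᵏ with p and q.
theorem5p1 : (n p : ℕ) → 0 < n → Prime p →
    Σ ℕ (λ k₀ → (k : ℕ) → k₀ ≤ k →
    Σ ℕ (λ q → Prime q × q ≢ p × Condition1 (n * p ^ k) p q))
theorem5p1 n p 0<n pp = suc (n !) , large-exponent
  where
  1<p : 1 < p
  1<p = prime>1 pp
  large-exponent : (k : ℕ) → suc (n !) ≤ k →
    Σ ℕ (λ q → Prime q × q ≢ p × Condition1 (n * p ^ k) p q)
  large-exponent (suc k) n!<k with factorial-or-large-prime-power n (suc (p ^ suc k))
  ... | inj₁ pᵏ⁺¹+1∣n! = ⊥-elim (<⇒≱ n!<pᵏ⁺¹+1 (∣⇒≤ {{n !≢0}} pᵏ⁺¹+1∣n!))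
    where
    n!<pᵏ⁺¹+1 : n ! < suc (p ^ suc k)
    n!<pᵏ⁺¹+1 = m<n⇒m<1+n (<-trans n!<k (n<m^n 1<p (suc k)))
  ... | inj₂ (q , e , pq , qᵉ∣pᵏ⁺¹+1 , n<qᵉ) =
    q , pq , q≢p , condition1-from-prime-powers pp pq (suc k) (suc e) n 0<n (<⇒≤ n<qᵉ) qᵉ∣pᵏ⁺¹+1
    where
    q≢p : q ≢ p
    q≢p refl = ∤-suc-power 1<p k (∣-trans (m∣m*n (q ^ e)) qᵉ∣pᵏ⁺¹+1)
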